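{- Let $G$ be a graph with radius $r$ and order $n$ such that there is a vertex $v$ of $G$ for which $G - v$ also has radius $r$ and the distance function of $G-v$ equals the restriction of the distance function of $G$. Then $W(G) \ge W(G - v)+n-1+(r-1)^2$. Equality holds if and only if $G$ contains as a subgraph a path $w_{r}w_{r-1}\cdots w_1 u_1 u_2 \cdots u_r$ with $v=w_1$ such that $d_G(w_r,u_1)=d_G(w_1,u_r)=r$ and $d_G(v,w)=1$ for every vertex $w$ of $G$ not on this path.
   Context: $W(G)=\sum_{\{u,v\}\subset V} d(u,v)$ over unordered pairs of distinct vertices; the radius is $\min_v\max_u d(v,u)$; $G-v$ is $G$ with vertex $v$ deleted. -}

module Defs where

open import Data.Nat using (ℕ; zero; suc; _+_; _≤_; _⊔_; _⊓_)
open import Data.Fin using (Fin; toℕ; punchIn; _<?_)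
open import Data.List using (List; foldr; map)
open import Data.Nat.ListAction using (sum)
open import Data.Product using (_×_; ∃)
open import Relation.Binary.PropositionalEquality using (_≡_)
open import Relation.Nullary using (¬_; does)
open import Data.Bool using (if_then_else_)
import Data.List as L

record SimpleGraph (n : ℕ) : Set₁ where
  field
    Adj    : Fin n → Fin n → Set
    sym    : ∀ {x y} → Adj x y → Adj y x
    irrefl : ∀ {x} → ¬ Adj x x
open SimpleGraph public

deleteVertex : ∀ {m} → SimpleGraph (suc m) → Fin (suc m) → SimpleGraph m
deleteVertex G v = record
  { Adj = λ x y → Adj G (punchIn v x) (punchIn v y)
  ; sym = sym G
  ; irrefl = irrefl G }

data Walk {n} (G : SimpleGraph n) : Fin n → Fin n → ℕ → Set where
  nil  : ∀ {x} → Walk G x x 0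
  cons : ∀ {x y z k} → Adj G x y → Walk G y z k → Walk G x z (suc k)

-- d is the (shortest-path) distance function of G (in particular G is connected).
IsDistanceFn : ∀ {n} → SimpleGraph n → (Fin n → Fin n → ℕ) → Set
IsDistanceFn G d = ∀ x y → Walk G x y (d x y) × (∀ k → Walk G x y k → d x y ≤ k)

ecc : ∀ {n} → (Fin n → Fin n → ℕ) → Fin n → ℕ
ecc {n} d x = foldr (λ u acc → d x u ⊔ acc) 0 (L.allFin n)

IsRadius : ∀ {n} → (Fin n → Fin n → ℕ) → ℕ → Set
IsRadius d r = (∃ λ x → ecc d x ≡ r) × (∀ y → r ≤ ecc d y)

wiener : ∀ {n} → (Fin n → Fin n → ℕ) → ℕ
wiener {n} d = sum (map (λ i → sum (map (λ j → if does (i <? j) then d i j else 0) (L.allFin n))) (L.allFin n))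

-- Write ℓ x = d v x. As G − v is isometric to its image, W(G) = W(G − v) + (n − 1) + Σ_x (ℓ x ∸ 1),
-- and Σ_x (ℓ x ∸ 1) = Σ_{t ≥ 2} N t, where N t is the number of vertices of level ≥ t. Let p be a
-- geodesic from v to a farthest vertex. Since every eccentricity is at least r, some p s has a vertex a
-- at distance ≥ r that is not reached from v through p s. The geodesic q from v to a leaves p below
-- level s, and p together with the part of q beyond the branch point contains 2(r − t) + 1 vertices of
-- level ≥ t. Summing these odd numbers over 2 ≤ t ≤ r gives (r − 1)².
-- With equality every count is tight: ecc v = r, and the radius of G − v provides a vertex a of level
-- r − 1 with d (p 1) a = r; the geodesic to a and p 1 … p r form the path, and every other vertex is
-- adjacent to v. Conversely, along such a path Σ_x (ℓ x ∸ 1) ≤ Σ_{i ≤ r − 1} ((i ∸ 1) + i) = (r − 1)².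

module Submission where

open import Defs hiding (sym)
open import Data.Nat
open import Data.Nat.Properties
open import Algebra.Properties.CommutativeMonoid.Sum +-0-commutativeMonoid
  using (sum-syntax; sum-cong-≗; sum-remove; sum-replicate-zero; ∑-distrib-+; ∑-comm; sum-init-last; ∑-permute)
open import Algebra.Properties.CommutativeSemigroup +-commutativeSemigroup using (x∙yz≈y∙xz; interchange)
open import Data.Bool using (if_then_else_)
open import Data.Empty using (⊥-elim)
open import Data.Fin as Fin using (Fin; toℕ; punchIn; punchOut; inject₁; fromℕ; fromℕ<; opposite) renaming (zero to fzero; suc to fsuc)
import Data.Fin.Properties as Finₚ
open import Data.Fin.Permutation using (reverse)
open import Data.List using (List; []; _∷_; _++_; map; foldr; length; tabulate; allFin; applyUpTo)
open import Data.List.Membership.Propositional using (_∈_; _∉_)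
open import Data.List.Membership.Propositional.Properties using (∈-allFin; ∈-applyUpTo⁻; ∈-tabulate⁺; ∈-++⁺ˡ; ∈-++⁺ʳ)
open import Data.List.Properties using (length-++; length-applyUpTo; map-++; map-tabulate; map-cong-local)
open import Data.List.Relation.Binary.Disjoint.Propositional using (Disjoint)
open import Data.List.Relation.Unary.All as All using (All; []; _∷_)
import Data.List.Relation.Unary.All.Properties as Allₚ
open import Data.List.Relation.Unary.Any using (here; there)
open import Data.List.Relation.Unary.Unique.Propositional using (Unique; []; _∷_)
import Data.List.Relation.Unary.Unique.Propositional.Properties as Uniqueₚ
open import Data.Nat.ListAction using (sum)
open import Data.Nat.ListAction.Properties using (sum-++)
open import Data.Nat.Tactic.RingSolver using (solve-∀)
open import Data.Product using (_×_; _,_; proj₁; proj₂; ∃; Σ)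
open import Data.Sum using (inj₁; inj₂)
open import Data.Vec.Functional using (updateAt)
open import Data.Vec.Functional.Properties using (updateAt-updates; updateAt-minimal)
open import Function using (_∘_; id; const)
open import Function.Bundles using (_⇔_; mk⇔)
open import Relation.Binary.PropositionalEquality hiding (J)
open import Relation.Nullary using (¬_; Dec; does; yes; no; contradiction)
open import Relation.Nullary.Decidable using (dec-true; dec-false)

-- Finite sums

∑-mono-≤ : ∀ {n} {f g : Fin n → ℕ} → (∀ i → f i ≤ g i) → ∑[ i < n ] f i ≤ ∑[ i < n ] g i
∑-mono-≤ {zero}  f≤g = z≤n
∑-mono-≤ {suc n} f≤g = +-mono-≤ (f≤g fzero) (∑-mono-≤ (f≤g ∘ fsuc))

∑-mono-< : ∀ {n} {f g : Fin n → ℕ} → (∀ i → f i ≤ g i) → ∀ j → f j < g j →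
           ∑[ i < n ] f i < ∑[ i < n ] g i
∑-mono-< {suc n} {f} {g} f≤g j fj<gj = begin-strict
  ∑[ i < suc n ] f i                      ≡⟨ sum-remove {i = j} f ⟩
  f j + ∑[ i < n ] f (punchIn j i)        <⟨ +-mono-<-≤ fj<gj (∑-mono-≤ (f≤g ∘ punchIn j)) ⟩
  g j + ∑[ i < n ] g (punchIn j i)        ≡⟨ sum-remove {i = j} g ⟨
  ∑[ i < suc n ] g i                      ∎
  where open ≤-Reasoning

sum-tabulate : ∀ {n} (f : Fin n → ℕ) → sum (tabulate f) ≡ ∑[ i < n ] f i
sum-tabulate {zero}  f = refl
sum-tabulate {suc n} f = cong (f fzero +_) (sum-tabulate (f ∘ fsuc))

sum-map-tabulate : ∀ {A : Set} {n} (g : A → ℕ) (f : Fin n → A) → sum (map g (tabulate f)) ≡ ∑[ i < n ] g (f i)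
sum-map-tabulate g f = trans (cong sum (map-tabulate f g)) (sum-tabulate (g ∘ f))

∑-odd : ∀ k → ∑[ i < k ] suc (2 * toℕ i) ≡ k * k
∑-odd zero    = refl
∑-odd (suc k) = begin
  ∑[ i < suc k ] suc (2 * toℕ i)                          ≡⟨ sum-init-last {k} (λ i → suc (2 * toℕ i)) ⟩
  ∑[ i < k ] suc (2 * toℕ (inject₁ i)) + suc (2 * toℕ (fromℕ k))
    ≡⟨ cong₂ (λ a b → a + suc (2 * b)) (sum-cong-≗ {k} (λ i → cong (λ j → suc (2 * j)) (Finₚ.toℕ-inject₁ i))) (Finₚ.toℕ-fromℕ k) ⟩
  ∑[ i < k ] suc (2 * toℕ i) + suc (2 * k)                ≡⟨ cong (_+ suc (2 * k)) (∑-odd k) ⟩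
  k * k + suc (2 * k)                                     ≡⟨ square-suc k ⟩
  suc k * suc k                                           ∎
  where
  open ≡-Reasoning
  square-suc : ∀ k → k * k + suc (2 * k) ≡ suc k * suc k
  square-suc = solve-∀

∑-updateAt-zero : ∀ {n} (g : Fin n → ℕ) y → ∑[ x < n ] g x ≡ g y + ∑[ x < n ] updateAt g y (const 0) x
∑-updateAt-zero g fzero    = refl
∑-updateAt-zero g (fsuc y) = begin
  g fzero + ∑[ x < _ ] g (fsuc x)                                               ≡⟨ cong (g fzero +_) (∑-updateAt-zero (g ∘ fsuc) y) ⟩
  g fzero + (g (fsuc y) + ∑[ x < _ ] updateAt (g ∘ fsuc) y (const 0) x)         ≡⟨ x∙yz≈y∙xz (g fzero) (g (fsuc y)) _ ⟩
  g (fsuc y) + (g fzero + ∑[ x < _ ] updateAt (g ∘ fsuc) y (const 0) x)         ∎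
  where open ≡-Reasoning

updateAt-zero-≤ : ∀ {n} (g : Fin n → ℕ) y x → updateAt g y (const 0) x ≤ g x
updateAt-zero-≤ g y x with x Fin.≟ y
... | yes refl = ≤-trans (≤-reflexive (updateAt-updates y g)) z≤n
... | no x≢y   = ≤-reflexive (updateAt-minimal x y g x≢y)

sum-map≤∑ : ∀ {n} (g : Fin n → ℕ) {xs} → Unique xs → sum (map g xs) ≤ ∑[ x < n ] g x
sum-map≤∑ g [] = z≤n
sum-map≤∑ g {y ∷ xs} (y∉xs ∷ unique) = begin
  g y + sum (map g xs)
    ≡⟨ cong (λ zs → g y + sum zs) (map-cong-local (All.map (λ y≢x → sym (updateAt-minimal _ y g (y≢x ∘ sym))) y∉xs)) ⟩
  g y + sum (map (λ x → updateAt g y (const 0) x) xs) ≤⟨ +-monoʳ-≤ (g y) (sum-map≤∑ _ unique) ⟩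
  g y + ∑[ x < _ ] updateAt g y (const 0) x          ≡⟨ ∑-updateAt-zero g y ⟨
  ∑[ x < _ ] g x                                    ∎
  where open ≤-Reasoning

length≤∑ : ∀ {n} (g : Fin n → ℕ) {xs} → Unique xs → All (λ x → 1 ≤ g x) xs → length xs ≤ ∑[ x < n ] g x
length≤∑ g {xs} unique positive = ≤-trans (length≤sum xs positive) (sum-map≤∑ g unique)
  where
  length≤sum : ∀ xs → All (λ x → 1 ≤ g x) xs → length xs ≤ sum (map g xs)
  length≤sum []       []            = z≤n
  length≤sum (x ∷ xs) (1≤gx ∷ rest) = +-mono-≤ 1≤gx (length≤sum xs rest)

∑≤sum-map : ∀ {n} (g : Fin n → ℕ) xs → (∀ x → x ∉ xs → g x ≡ 0) → ∑[ x < n ] g x ≤ sum (map g xs)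
∑≤sum-map {n} g [] vanishes = ≤-reflexive (trans (sum-cong-≗ (λ x → vanishes x λ ())) (sum-replicate-zero n))
∑≤sum-map g (y ∷ xs) vanishes = begin
  ∑[ x < _ ] g x                                    ≡⟨ ∑-updateAt-zero g y ⟩
  g y + ∑[ x < _ ] updateAt g y (const 0) x          ≤⟨ +-monoʳ-≤ (g y) (∑≤sum-map _ xs vanishes′) ⟩
  g y + sum (map (λ x → updateAt g y (const 0) x) xs) ≤⟨ +-monoʳ-≤ (g y) (sum-map-mono xs) ⟩
  g y + sum (map g xs)                              ∎
  where
  open ≤-Reasoning
  vanishes′ : ∀ x → x ∉ xs → updateAt g y (const 0) x ≡ 0
  vanishes′ x x∉xs with x Fin.≟ y
  ... | yes refl = updateAt-updates y g
  ... | no x≢y   = trans (updateAt-minimal x y g x≢y) (vanishes x λ { (here x≡y) → x≢y x≡y ; (there x∈xs) → x∉xs x∈xs })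
  sum-map-mono : ∀ zs → sum (map (λ x → updateAt g y (const 0) x) zs) ≤ sum (map g zs)
  sum-map-mono []       = z≤n
  sum-map-mono (z ∷ zs) = +-mono-≤ (updateAt-zero-≤ g y z) (sum-map-mono zs)

∑-1 : ∀ n → ∑[ i < n ] 1 ≡ n
∑-1 zero    = refl
∑-1 (suc n) = cong suc (∑-1 n)

n+[1+n]≡1+2*n : ∀ n → n + suc n ≡ suc (2 * n)
n+[1+n]≡1+2*n n = trans (+-suc n n) (cong (λ x → suc (n + x)) (sym (+-identityʳ n)))

i<m∸a⇒a+i<m : ∀ a m {i} → i < m ∸ a → a + i < m
i<m∸a⇒a+i<m zero    m       i<m   = i<m
i<m∸a⇒a+i<m (suc a) (suc m) i<m∸a = s≤s (i<m∸a⇒a+i<m a m i<m∸a)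

≤-∸+∸ : ∀ {x a b A B} → x + (a + b) ≤ A + B → x ≤ (A ∸ a) + (B ∸ b)
≤-∸+∸ {x} {a} {b} {A} {B} x+a+b≤A+B = +-cancelˡ-≤ (a + b) x _ (begin
  (a + b) + x                          ≡⟨ +-comm (a + b) x ⟩
  x + (a + b)                          ≤⟨ x+a+b≤A+B ⟩
  A + B                                ≤⟨ +-mono-≤ (m≤n+m∸n A a) (m≤n+m∸n B b) ⟩
  (a + (A ∸ a)) + (b + (B ∸ b))        ≡⟨ interchange a (A ∸ a) b (B ∸ b) ⟩
  (a + b) + ((A ∸ a) + (B ∸ b))        ∎)
  where open ≤-Reasoning

lastBelow : ∀ {p} {P : ℕ → Set p} → (∀ j → Dec (P j)) → P 0 → ∀ B →
            ∃ λ J → J ≤ B × P J × (∀ {j} → J < j → j ≤ B → ¬ P j)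
lastBelow P? P0 zero = 0 , z≤n , P0 , λ J<j j≤0 → ⊥-elim (<-irrefl refl (<-≤-trans J<j j≤0))
lastBelow P? P0 (suc B) with P? (suc B)
... | yes PB = suc B , ≤-refl , PB , λ J<j j≤1+B → ⊥-elim (<-irrefl refl (<-≤-trans J<j j≤1+B))
... | no ¬PB with lastBelow P? P0 B
...   | J , J≤B , PJ , last = J , m≤n⇒m≤1+n J≤B , PJ , last′
  where
  last′ : ∀ {j} → J < j → j ≤ suc B → ¬ _
  last′ {j} J<j j≤1+B with j ≟ suc B
  ... | yes refl = ¬PB
  ... | no j≢1+B = last J<j (≤-pred (≤∧≢⇒< j≤1+B j≢1+B))

-- Eccentricity and distances

module _ {A : Set} (f : A → ℕ) where

  foldr-⊔-upper : ∀ {u xs} → u ∈ xs → f u ≤ foldr (λ x acc → f x ⊔ acc) 0 xs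
  foldr-⊔-upper {xs = x ∷ xs} (here refl)  = m≤m⊔n (f x) _
  foldr-⊔-upper {xs = x ∷ xs} (there u∈xs) = ≤-trans (foldr-⊔-upper u∈xs) (m≤n⊔m (f x) _)

  foldr-⊔-attained : A → ∀ xs → ∃ λ u → foldr (λ x acc → f x ⊔ acc) 0 xs ≤ f u
  foldr-⊔-attained y []       = y , z≤n
  foldr-⊔-attained y (x ∷ xs) with ⊔-sel (f x) (foldr (λ x acc → f x ⊔ acc) 0 xs)
  ... | inj₁ max≡fx   = x , ≤-reflexive max≡fx
  ... | inj₂ max≡rest = let u , rest≤fu = foldr-⊔-attained y xs in u , ≤-trans (≤-reflexive max≡rest) rest≤fu

module _ {n} (d : Fin n → Fin n → ℕ) where

  d≤ecc : ∀ x u → d x u ≤ ecc d x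
  d≤ecc x u = foldr-⊔-upper (d x) (∈-allFin u)

  ecc-attained : ∀ x → ∃ λ u → d x u ≡ ecc d x
  ecc-attained x = let u , ecc≤ = foldr-⊔-attained (d x) x (allFin n) in u , ≤-antisym (d≤ecc x u) ecc≤

  ecc-witness : ∀ x {k} → k ≤ ecc d x → ∃ λ u → k ≤ d x u
  ecc-witness x k≤ecc = let u , du≡ecc = ecc-attained x in u , ≤-trans k≤ecc (≤-reflexive (sym du≡ecc))

module _ {n} {G : SimpleGraph n} where

  _++ᵂ_ : ∀ {x y z k l} → Walk G x y k → Walk G y z l → Walk G x z (k + l)
  nil      ++ᵂ w′ = w′
  cons e w ++ᵂ w′ = cons e (w ++ᵂ w′)

  snocᵂ : ∀ {x y z k} → Walk G x y k → Adj G y z → Walk G x z (suc k)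
  snocᵂ nil        e′ = cons e′ nil
  snocᵂ (cons e w) e′ = cons e (snocᵂ w e′)

  reverseᵂ : ∀ {x y k} → Walk G x y k → Walk G y x k
  reverseᵂ nil        = nil
  reverseᵂ (cons e w) = snocᵂ (reverseᵂ w) (SimpleGraph.sym G e)

  vertexAt : ∀ {x y k} → Walk G x y k → ℕ → Fin n
  vertexAt {x} w          zero    = x
  vertexAt {x} nil        (suc i) = x
  vertexAt     (cons e w) (suc i) = vertexAt w i

  vertexAt-end : ∀ {x y k} (w : Walk G x y k) → vertexAt w k ≡ y
  vertexAt-end nil        = refl
  vertexAt-end (cons e w) = vertexAt-end w

  vertexAt-adj : ∀ {x y k} (w : Walk G x y k) {i} → suc i ≤ k → Adj G (vertexAt w i) (vertexAt w (suc i))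
  vertexAt-adj (cons e w) {zero}  _           = e
  vertexAt-adj (cons e w) {suc i} (s≤s i<k) = vertexAt-adj w i<k

  subwalk : ∀ {x y k} (w : Walk G x y k) {i j} → i ≤ j → j ≤ k → Walk G (vertexAt w i) (vertexAt w j) (j ∸ i)
  subwalk w          {zero}  {zero}  _         _         = nil
  subwalk (cons e w) {zero}  {suc j} _         (s≤s j≤k) = cons e (subwalk w z≤n j≤k)
  subwalk (cons e w) {suc i} {suc j} (s≤s i≤j) (s≤s j≤k) = subwalk w i≤j j≤k

  chainWalk : ∀ {k} (z : Fin (suc k) → Fin n) → (∀ (i : Fin k) → Adj G (z (inject₁ i)) (z (fsuc i))) →
              ∀ i → Walk G (z fzero) (z i) (toℕ i)
  chainWalk z adj fzero = nil
  chainWalk {suc k} z adj (fsuc i) = cons (adj fzero) (chainWalk (z ∘ fsuc) (adj ∘ fsuc) i)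

module Distance {n} {G : SimpleGraph n} {d : Fin n → Fin n → ℕ} (isDist : IsDistanceFn G d) where

  geodesic : ∀ x y → Walk G x y (d x y)
  geodesic x y = proj₁ (isDist x y)

  d-minimal : ∀ {x y k} → Walk G x y k → d x y ≤ k
  d-minimal {x} {y} {k} w = proj₂ (isDist x y) k w

  d-triangle : ∀ x y z → d x z ≤ d x y + d y z
  d-triangle x y z = d-minimal (geodesic x y ++ᵂ geodesic y z)

  d-sym : ∀ x y → d x y ≡ d y x
  d-sym x y = ≤-antisym (d-minimal (reverseᵂ (geodesic y x))) (d-minimal (reverseᵂ (geodesic x y)))

  d-refl : ∀ x → d x x ≡ 0
  d-refl x = n≤0⇒n≡0 (d-minimal {x} nil)

  d≡0⇒≡ : ∀ {x y} → d x y ≡ 0 → x ≡ y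
  d≡0⇒≡ {x} {y} d≡0 = walk₀ (subst (Walk G x y) d≡0 (geodesic x y))
    where
    walk₀ : Walk G x y 0 → x ≡ y
    walk₀ nil = refl

  d-adj : ∀ {x y} → Adj G x y → d x y ≤ 1
  d-adj e = d-minimal (cons e nil)

  d-chain : ∀ {k} (z : Fin (suc k) → Fin n) → (∀ (i : Fin k) → Adj G (z (inject₁ i)) (z (fsuc i))) →
            ∀ i → d (z fzero) (z i) ≤ toℕ i
  d-chain z adj i = d-minimal (chainWalk z adj i)

  path : Fin n → Fin n → ℕ → Fin n
  path x y = vertexAt (geodesic x y)

  path-end : ∀ x y → path x y (d x y) ≡ y
  path-end x y = vertexAt-end (geodesic x y)

  path-adj : ∀ x y {i} → suc i ≤ d x y → Adj G (path x y i) (path x y (suc i))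
  path-adj x y = vertexAt-adj (geodesic x y)

  d-path-path : ∀ x y {i j} → i ≤ j → j ≤ d x y → d (path x y i) (path x y j) ≤ j ∸ i
  d-path-path x y i≤j j≤d = d-minimal (subwalk (geodesic x y) i≤j j≤d)

  d-path-end : ∀ x y {i} → i ≤ d x y → d (path x y i) y ≤ d x y ∸ i
  d-path-end x y {i} i≤d = subst (λ z → d (path x y i) z ≤ d x y ∸ i) (path-end x y) (d-path-path x y i≤d ≤-refl)

  d-path : ∀ x y {i} → i ≤ d x y → d x (path x y i) ≡ i
  d-path x y {i} i≤d = ≤-antisym (d-path-path x y z≤n i≤d) (begin
    i                                ≡⟨ m∸[m∸n]≡n i≤d ⟨
    d x y ∸ (d x y ∸ i)              ≤⟨ m≤n+o⇒m∸n≤o (d x y) (d x y ∸ i) (subst (d x y ≤_) (+-comm _ (d x y ∸ i)) via-path) ⟩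
    d x (path x y i)                 ∎)
    where
    open ≤-Reasoning
    via-path : d x y ≤ d x (path x y i) + (d x y ∸ i)
    via-path = ≤-trans (d-triangle x (path x y i) y) (+-monoʳ-≤ (d x (path x y i)) (d-path-end x y i≤d))

  ecc-positive : ∀ {x y} → x ≢ y → ∀ z → 1 ≤ ecc d z
  ecc-positive {x} {y} x≢y z = n≢0⇒n>0 λ ecc≡0 → x≢y (trans (sym (is-center x ecc≡0)) (is-center y ecc≡0))
    where
    is-center : ∀ u → ecc d z ≡ 0 → z ≡ u
    is-center u ecc≡0 = d≡0⇒≡ (n≤0⇒n≡0 (subst (d z u ≤_) ecc≡0 (d≤ecc d z u)))

-- The Wiener index

module _ {n} (d : Fin n → Fin n → ℕ) where

  below : Fin n → Fin n → ℕ
  below i j = if does (i Fin.<? j) then d i j else 0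

  below-< : ∀ {i j} → i Fin.< j → below i j ≡ d i j
  below-< {i} {j} i<j rewrite dec-true (i Fin.<? j) i<j = refl

  below-≮ : ∀ {i j} → ¬ i Fin.< j → below i j ≡ 0
  below-≮ {i} {j} i≮j rewrite dec-false (i Fin.<? j) i≮j = refl

  wiener≡∑below : wiener d ≡ ∑[ i < n ] ∑[ j < n ] below i j
  wiener≡∑below = trans (sum-map-tabulate (λ i → sum (map (below i) (allFin n))) id)
                        (sum-cong-≗ (λ i → sum-map-tabulate (below i) id))

  module _ (d-sym : ∀ i j → d i j ≡ d j i) (d-refl : ∀ i → d i i ≡ 0) where

    below-split : ∀ i j → d i j ≡ below i j + below j i
    below-split i j with i Fin.<? j | j Fin.<? i
    ... | yes i<j | yes j<i = ⊥-elim (Finₚ.<-asym i<j j<i)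
    ... | yes i<j | no j≮i  = sym (trans (cong₂ _+_ (below-< i<j) (below-≮ j≮i)) (+-identityʳ (d i j)))
    ... | no i≮j  | yes j<i = trans (d-sym i j) (sym (cong₂ _+_ (below-≮ i≮j) (below-< j<i)))
    ... | no i≮j  | no j≮i with Finₚ.≤-antisym (≮⇒≥ j≮i) (≮⇒≥ i≮j)
    ...   | refl = trans (d-refl i) (sym (cong₂ _+_ (below-≮ i≮j) (below-≮ i≮j)))

    ∑∑≡2*wiener : ∑[ i < n ] ∑[ j < n ] d i j ≡ 2 * wiener d
    ∑∑≡2*wiener = begin
      ∑[ i < n ] ∑[ j < n ] d i j                                        ≡⟨ sum-cong-≗ (λ i → sum-cong-≗ (below-split i)) ⟩
      ∑[ i < n ] ∑[ j < n ] (below i j + below j i)                      ≡⟨ sum-cong-≗ (λ i → ∑-distrib-+ (below i) (λ j → below j i)) ⟩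
      ∑[ i < n ] (∑[ j < n ] below i j + ∑[ j < n ] below j i)
        ≡⟨ ∑-distrib-+ {n} (λ i → ∑[ j < n ] below i j) (λ i → ∑[ j < n ] below j i) ⟩
      ∑[ i < n ] ∑[ j < n ] below i j + ∑[ i < n ] ∑[ j < n ] below j i
        ≡⟨ cong (∑[ i < n ] ∑[ j < n ] below i j +_) (∑-comm {n} {n} (λ i j → below j i)) ⟩
      ∑[ i < n ] ∑[ j < n ] below i j + ∑[ j < n ] ∑[ i < n ] below j i  ≡⟨ cong₂ _+_ wiener≡∑below wiener≡∑below ⟨
      wiener d + wiener d                                                ≡⟨ cong (wiener d +_) (+-identityʳ (wiener d)) ⟨
      2 * wiener d                                                       ∎
      where open ≡-Reasoning

-- Both sides are compared after doubling, because the full double sum counts every pair twice.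
wiener-removeVertex : ∀ {m} (d : Fin (suc m) → Fin (suc m) → ℕ) (d′ : Fin m → Fin m → ℕ) v →
                      (∀ i j → d i j ≡ d j i) → (∀ i → d i i ≡ 0) →
                      (∀ x y → d′ x y ≡ d (punchIn v x) (punchIn v y)) →
                      wiener d ≡ wiener d′ + ∑[ x < m ] d v (punchIn v x)
wiener-removeVertex {m} d d′ v d-sym d-refl restrict = *-cancelˡ-≡ (wiener d) _ 2 (begin
  2 * wiener d                                                                        ≡⟨ ∑∑≡2*wiener d d-sym d-refl ⟨
  ∑[ i < suc m ] ∑[ j < suc m ] d i j                                                 ≡⟨ sum-remove {i = v} (λ i → ∑[ j < suc m ] d i j) ⟩
  ∑[ j < suc m ] d v j + ∑[ i < m ] ∑[ j < suc m ] d (punchIn v i) j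
    ≡⟨ cong₂ _+_ (sum-remove {i = v} (d v)) (sum-cong-≗ (λ i → sum-remove {i = v} (d (punchIn v i)))) ⟩
  (d v v + T) + ∑[ i < m ] (d (punchIn v i) v + ∑[ j < m ] d (punchIn v i) (punchIn v j))
    ≡⟨ cong₂ _+_ (cong (_+ T) (d-refl v)) (sum-cong-≗ (λ i → cong₂ _+_ (d-sym _ v) (sum-cong-≗ (λ j → sym (restrict i j))))) ⟩
  T + ∑[ i < m ] (d v (punchIn v i) + ∑[ j < m ] d′ i j)                              ≡⟨ cong (T +_) (∑-distrib-+ (d v ∘ punchIn v) _) ⟩
  T + (T + ∑[ i < m ] ∑[ j < m ] d′ i j)                                              ≡⟨ cong (λ x → T + (T + x)) (∑∑≡2*wiener d′ d′-sym d′-refl) ⟩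
  T + (T + 2 * wiener d′)                                                             ≡⟨ regroup T (wiener d′) ⟩
  2 * (wiener d′ + T)                                                                 ∎)
  where
  open ≡-Reasoning
  T : ℕ
  T = ∑[ x < m ] d v (punchIn v x)
  d′-sym : ∀ i j → d′ i j ≡ d′ j i
  d′-sym i j = trans (restrict i j) (trans (d-sym _ _) (sym (restrict j i)))
  d′-refl : ∀ i → d′ i i ≡ 0
  d′-refl i = trans (restrict i i) (d-refl _)
  regroup : ∀ t w → t + (t + 2 * w) ≡ 2 * (w + t)
  regroup = solve-∀

surplus : ∀ {n} → (Fin n → Fin n → ℕ) → Fin n → ℕ
surplus {n} d v = ∑[ x < n ] (d v x ∸ 1)

wiener-deleteVertex : ∀ {m} {G : SimpleGraph (suc m)} {d : Fin (suc m) → Fin (suc m) → ℕ} → IsDistanceFn G d →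
                      ∀ v {d′ : Fin m → Fin m → ℕ} → (∀ x y → d′ x y ≡ d (punchIn v x) (punchIn v y)) →
                      wiener d ≡ wiener d′ + m + surplus d v
wiener-deleteVertex {m} {d = d} isDist v {d′} restrict = begin
  wiener d                                                     ≡⟨ wiener-removeVertex d d′ v d-sym d-refl restrict ⟩
  wiener d′ + ∑[ x < m ] d v (punchIn v x)                     ≡⟨ cong (wiener d′ +_) (sum-cong-≗ {m} λ x → sym (m+[n∸m]≡n (positive x))) ⟩
  wiener d′ + ∑[ x < m ] (1 + (d v (punchIn v x) ∸ 1))         ≡⟨ cong (wiener d′ +_) (∑-distrib-+ {m} (λ _ → 1) (λ x → d v (punchIn v x) ∸ 1)) ⟩
  wiener d′ + (∑[ x < m ] 1 + ∑[ x < m ] (d v (punchIn v x) ∸ 1))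
    ≡⟨ cong₂ (λ a b → wiener d′ + (a + b)) (∑-1 m) surplus-punchIn ⟩
  wiener d′ + (m + surplus d v)                                ≡⟨ +-assoc (wiener d′) m _ ⟨
  wiener d′ + m + surplus d v                                  ∎
  where
  open ≡-Reasoning
  open Distance isDist
  positive : ∀ x → 1 ≤ d v (punchIn v x)
  positive x = n≢0⇒n>0 λ d≡0 → Finₚ.punchInᵢ≢i v x (sym (d≡0⇒≡ d≡0))
  surplus-punchIn : ∑[ x < m ] (d v (punchIn v x) ∸ 1) ≡ surplus d v
  surplus-punchIn = trans (cong (λ z → z ∸ 1 + ∑[ x < m ] (d v (punchIn v x) ∸ 1)) (sym (d-refl v)))
                          (sym (sum-remove {i = v} (λ x → d v x ∸ 1)))

-- Counting vertices by level

𝟙[_≤_] : ℕ → ℕ → ℕ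
𝟙[ t ≤ L ] = if does (t ≤? L) then 1 else 0

𝟙-≤ : ∀ {t L} → t ≤ L → 𝟙[ t ≤ L ] ≡ 1
𝟙-≤ {t} {L} t≤L rewrite dec-true (t ≤? L) t≤L = refl

𝟙-≰ : ∀ {t L} → ¬ t ≤ L → 𝟙[ t ≤ L ] ≡ 0
𝟙-≰ {t} {L} t≰L rewrite dec-false (t ≤? L) t≰L = refl

𝟙+∸ : ∀ a L → 𝟙[ suc a ≤ L ] + (L ∸ suc a) ≡ L ∸ a
𝟙+∸ a L with suc a ≤? L
... | yes a<L = trans (cong (_+ (L ∸ suc a)) (𝟙-≤ a<L)) (sym (+-∸-assoc 1 a<L))
... | no a≮L  = trans (cong (_+ (L ∸ suc a)) (𝟙-≰ a≮L))
                      (trans (m≤n⇒m∸n≡0 (≤-trans (≮⇒≥ a≮L) (n≤1+n a))) (sym (m≤n⇒m∸n≡0 (≮⇒≥ a≮L))))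

∑𝟙≤∸ : ∀ c a L → ∑[ i < c ] 𝟙[ suc (a + toℕ i) ≤ L ] ≤ L ∸ a
∑𝟙≤∸ zero    a L = z≤n
∑𝟙≤∸ (suc c) a L = begin
  𝟙[ suc (a + 0) ≤ L ] + ∑[ i < c ] 𝟙[ suc (a + suc (toℕ i)) ≤ L ]
    ≡⟨ cong₂ (λ x y → 𝟙[ suc x ≤ L ] + y) (+-identityʳ a) (sum-cong-≗ {c} (λ i → cong (λ x → 𝟙[ suc x ≤ L ]) (+-suc a (toℕ i)))) ⟩
  𝟙[ suc a ≤ L ] + ∑[ i < c ] 𝟙[ suc (suc a + toℕ i) ≤ L ]   ≤⟨ +-monoʳ-≤ 𝟙[ suc a ≤ L ] (∑𝟙≤∸ c (suc a) L) ⟩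
  𝟙[ suc a ≤ L ] + (L ∸ suc a)                               ≡⟨ 𝟙+∸ a L ⟩
  L ∸ a                                                      ∎
  where open ≤-Reasoning

module Levels {n} (ℓ : Fin n → ℕ) where

  countAtLeast : ℕ → ℕ
  countAtLeast t = ∑[ x < n ] 𝟙[ t ≤ ℓ x ]

  length≤countAtLeast : ∀ {t xs} → Unique xs → All (λ x → t ≤ ℓ x) xs → length xs ≤ countAtLeast t
  length≤countAtLeast unique high = length≤∑ _ unique (All.map (λ t≤ℓx → ≤-reflexive (sym (𝟙-≤ t≤ℓx))) high)

  ∑countAtLeast≤∑ : ∀ c → ∑[ i < c ] countAtLeast (2 + toℕ i) ≤ ∑[ x < n ] (ℓ x ∸ 1)
  ∑countAtLeast≤∑ c = begin
    ∑[ i < c ] ∑[ x < n ] 𝟙[ 2 + toℕ i ≤ ℓ x ]   ≡⟨ ∑-comm {c} {n} (λ i x → 𝟙[ 2 + toℕ i ≤ ℓ x ]) ⟩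
    ∑[ x < n ] ∑[ i < c ] 𝟙[ 2 + toℕ i ≤ ℓ x ]   ≤⟨ ∑-mono-≤ (λ x → ∑𝟙≤∸ c 1 (ℓ x)) ⟩
    ∑[ x < n ] (ℓ x ∸ 1)                          ∎
    where open ≤-Reasoning

  segment : (ℕ → Fin n) → ℕ → ℕ → List (Fin n)
  segment g a c = applyUpTo (λ i → g (a + i)) c

  module _ (g : ℕ → Fin n) (a c : ℕ) (graded : ∀ {i} → i < c → ℓ (g (a + i)) ≡ a + i) where

    segment-unique : Unique (segment g a c)
    segment-unique = Uniqueₚ.applyUpTo⁺₁ _ c λ {i} {j} i<j j<c gi≡gj →
      <-irrefl (+-cancelˡ-≡ a i j (trans (sym (graded (<-trans i<j j<c))) (trans (cong ℓ gi≡gj) (graded j<c)))) i<j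

    segment-high : ∀ {t} → t ≤ a → All (λ x → t ≤ ℓ x) (segment g a c)
    segment-high t≤a = Allₚ.applyUpTo⁺₁ _ c λ {i} i<c → subst (_ ≤_) (sym (graded i<c)) (≤-trans t≤a (m≤m+n a i))

  levelSum : ℕ → ℕ
  levelSum k = ∑[ i < k ] countAtLeast (2 + toℕ i)

  levelSum+countAtLeast≤∑ : ∀ k → levelSum k + countAtLeast (2 + k) ≤ ∑[ x < n ] (ℓ x ∸ 1)
  levelSum+countAtLeast≤∑ k = begin
    levelSum k + countAtLeast (2 + k)
      ≡⟨ cong₂ (λ s t → s + countAtLeast (2 + t)) (sum-cong-≗ {k} (λ i → cong (λ j → countAtLeast (2 + j)) (Finₚ.toℕ-inject₁ i))) (Finₚ.toℕ-fromℕ k) ⟨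
    ∑[ i < k ] countAtLeast (2 + toℕ (inject₁ i)) + countAtLeast (2 + toℕ (fromℕ k))
      ≡⟨ sum-init-last {k} (λ i → countAtLeast (2 + toℕ i)) ⟨
    levelSum (suc k)                                                                 ≤⟨ ∑countAtLeast≤∑ (suc k) ⟩
    ∑[ x < n ] (ℓ x ∸ 1)                                                             ∎
    where open ≤-Reasoning

  module Thick (k : ℕ) (thick : ∀ {t} → 2 ≤ t → t ≤ suc k → suc (2 * (suc k ∸ t)) ≤ countAtLeast t) where

    thickAt : ∀ (i : Fin k) → suc (2 * toℕ (opposite i)) ≤ countAtLeast (2 + toℕ i)
    thickAt i = subst (λ j → suc (2 * j) ≤ countAtLeast (2 + toℕ i)) (sym (Finₚ.opposite-prop i)) (thick (s≤s (s≤s z≤n)) (s≤s (Finₚ.toℕ<n i)))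

    odd≡reversed : k * k ≡ ∑[ i < k ] suc (2 * toℕ (opposite i))
    odd≡reversed = trans (sym (∑-odd k)) (∑-permute {k} {k} (λ i → suc (2 * toℕ i)) reverse)

    square≤levelSum : k * k ≤ levelSum k
    square≤levelSum = ≤-trans (≤-reflexive odd≡reversed) (∑-mono-≤ thickAt)

    square<levelSum : ∀ i → suc (2 * toℕ (opposite i)) < countAtLeast (2 + toℕ i) → k * k < levelSum k
    square<levelSum i thin = ≤-<-trans (≤-reflexive odd≡reversed) (∑-mono-< thickAt i thin)

    square≤∑ : k * k ≤ ∑[ x < n ] (ℓ x ∸ 1)
    square≤∑ = ≤-trans square≤levelSum (≤-trans (m≤m+n (levelSum k) _) (levelSum+countAtLeast≤∑ k))

    module Tight (tight : ∑[ x < n ] (ℓ x ∸ 1) ≤ k * k) where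

      levelSum+top≤square : levelSum k + countAtLeast (2 + k) ≤ k * k
      levelSum+top≤square = ≤-trans (levelSum+countAtLeast≤∑ k) tight

      ℓ≤1+k : ∀ x → ℓ x ≤ suc k
      ℓ≤1+k x = ≮⇒≥ λ 1+k<ℓx → <-irrefl refl
        (≤-<-trans square≤levelSum (<-≤-trans (m<m+n (levelSum k) (length≤countAtLeast ([] ∷ []) (1+k<ℓx ∷ []))) levelSum+top≤square))

      countAtLeast≤ : ∀ {t} → 2 ≤ t → t ≤ suc k → countAtLeast t ≤ suc (2 * (suc k ∸ t))
      countAtLeast≤ {suc (suc t)} (s≤s (s≤s z≤n)) (s≤s t<k) = ≮⇒≥ λ thin → <-irrefl refl
        (<-≤-trans (square<levelSum i (subst₂ (λ j o → suc (2 * o) < countAtLeast (2 + j)) (sym toℕi≡t) (sym opposite-i) thin))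
                   (≤-trans (m≤m+n (levelSum k) (countAtLeast (2 + k))) levelSum+top≤square))
        where
        i : Fin k
        i = fromℕ< t<k
        toℕi≡t : toℕ i ≡ t
        toℕi≡t = Finₚ.toℕ-fromℕ< t<k
        opposite-i : toℕ (opposite i) ≡ k ∸ suc t
        opposite-i = trans (Finₚ.opposite-prop i) (cong (λ j → k ∸ suc j) toℕi≡t)

-- Thick levels around a vertex

branch-below-bound : ∀ {r s t E f} → r + s ≤ suc E → r ≤ s + f → t ≤ r → suc (2 * (r ∸ t)) + (t + t) ≤ suc E + suc f
branch-below-bound {s = s} {t} {E} {f} r+s≤1+E r≤s+f t≤r with m≤n⇒∃[o]m+o≡n t≤r
... | e , refl = begin
  suc (2 * (t + e ∸ t)) + (t + t)   ≡⟨ cong (λ x → suc (2 * x) + (t + t)) (m+n∸m≡n t e) ⟩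
  suc (2 * e) + (t + t)             ≡⟨ regroup t e ⟩
  suc ((t + e) + (t + e))           ≤⟨ s≤s (+-monoʳ-≤ (t + e) r≤s+f) ⟩
  suc ((t + e) + (s + f))           ≡⟨ cong suc (+-assoc (t + e) s f) ⟨
  suc ((t + e) + s + f)             ≤⟨ s≤s (+-monoˡ-≤ f r+s≤1+E) ⟩
  suc (suc E + f)                   ≡⟨ +-suc (suc E) f ⟨
  suc E + suc f                     ∎
  where
  open ≤-Reasoning
  regroup : ∀ t e → suc (2 * e) + (t + t) ≡ suc ((t + e) + (t + e))
  regroup = solve-∀

branch-above-bound : ∀ {r s t E f J} → r + s ≤ suc E → r + (J + J) ≤ s + f → 1 ≤ t → t ≤ r →
                     suc (2 * (r ∸ t)) + (t + suc J) ≤ suc E + suc f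
branch-above-bound {s = s} {suc t} {E} {f} {J} r+s≤1+E r+2J≤s+f _ t≤r with m≤n⇒∃[o]m+o≡n t≤r
... | e , refl = begin
  suc (2 * (suc t + e ∸ suc t)) + (suc t + suc J)          ≡⟨ cong (λ x → suc (2 * x) + (suc t + suc J)) (m+n∸m≡n (suc t) e) ⟩
  suc (2 * e) + (suc t + suc J)                            ≤⟨ m≤m+n _ (t + J) ⟩
  suc (2 * e) + (suc t + suc J) + (t + J)                  ≡⟨ regroup t e J ⟩
  suc ((suc t + e) + ((suc t + e) + (J + J)))              ≤⟨ s≤s (+-monoʳ-≤ (suc t + e) r+2J≤s+f) ⟩
  suc ((suc t + e) + (s + f))                              ≡⟨ cong suc (+-assoc (suc t + e) s f) ⟨
  suc ((suc t + e) + s + f)                                ≤⟨ s≤s (+-monoˡ-≤ f r+s≤1+E) ⟩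
  suc (suc E + f)                                          ≡⟨ +-suc (suc E) f ⟨
  suc E + suc f                                            ∎
  where
  open ≤-Reasoning
  regroup : ∀ t e J → suc (2 * e) + (suc t + suc J) + (t + J) ≡ suc ((suc t + e) + ((suc t + e) + (J + J)))
  regroup = solve-∀

module LevelStructure {n} {G : SimpleGraph n} {d : Fin n → Fin n → ℕ} (isDist : IsDistanceFn G d)
                      (v : Fin n) (r : ℕ) (r≤ecc : ∀ y → r ≤ ecc d y) where

  open Distance isDist

  ℓ : Fin n → ℕ
  ℓ = d v

  open Levels ℓ public

  far : Fin n
  far = proj₁ (ecc-attained d v)

  E : ℕ
  E = ℓ far

  ℓ≤E : ∀ x → ℓ x ≤ E
  ℓ≤E x = ≤-trans (d≤ecc d v x) (≤-reflexive (sym (proj₂ (ecc-attained d v))))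

  r≤E : r ≤ E
  r≤E = ≤-trans (r≤ecc v) (≤-reflexive (sym (proj₂ (ecc-attained d v))))

  p : ℕ → Fin n
  p = path v far

  ℓ-p : ∀ {i} → i ≤ E → ℓ (p i) ≡ i
  ℓ-p = d-path v far

  record Pivot : Set where
    field
      s          : ℕ
      a          : Fin n
      r+s≤1+E    : r + s ≤ suc E
      r≤d[ps,a]  : r ≤ d (p s) a
      not-behind : ℓ a < s + d (p s) a

  module _ (1≤r : 1 ≤ r) where

    s≤E : ∀ {s} → r + s ≤ suc E → s ≤ E
    s≤E {s} r+s≤1+E = ≤-pred (≤-trans (+-monoˡ-≤ s 1≤r) r+s≤1+E)

    -- If the vertex a found for p s lies behind p s, then r + s ≤ E and the search moves on to p (s + 1).
    findPivot : ∀ gap s → r + s + gap ≡ suc E → Pivot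
    findPivot gap s r+s+gap≡1+E with ecc-witness d (p s) (r≤ecc (p s))
    ... | a , r≤d with ℓ a ≟ s + d (p s) a
    ...   | no ℓa≢ = record { s = s ; a = a ; r+s≤1+E = r+s≤1+E ; r≤d[ps,a] = r≤d ; not-behind = ≤∧≢⇒< ℓa≤ ℓa≢ }
      where
      r+s≤1+E : r + s ≤ suc E
      r+s≤1+E = subst (r + s ≤_) r+s+gap≡1+E (m≤m+n (r + s) gap)
      ℓa≤ : ℓ a ≤ s + d (p s) a
      ℓa≤ = subst (λ z → ℓ a ≤ z + d (p s) a) (ℓ-p (s≤E r+s≤1+E)) (d-triangle v (p s) a)
    ...   | yes behind with gap
    ...     | zero    = ⊥-elim (<-irrefl (trans (sym (+-identityʳ (r + s))) r+s+gap≡1+E) (s≤s r+s≤E))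
      where
      r+s≤E : r + s ≤ E
      r+s≤E = begin
        r + s              ≡⟨ +-comm r s ⟩
        s + r              ≤⟨ +-monoʳ-≤ s r≤d ⟩
        s + d (p s) a      ≡⟨ behind ⟨
        ℓ a                ≤⟨ ℓ≤E a ⟩
        E                  ∎
        where open ≤-Reasoning
    ...     | suc gap = findPivot gap (suc s) (trans (cong (_+ gap) (+-suc r s)) (trans (sym (+-suc (r + s) gap)) r+s+gap≡1+E))

    pivot : Pivot
    pivot = findPivot (suc E ∸ r) 0 (trans (cong (_+ (suc E ∸ r)) (+-identityʳ r)) (m+[n∸m]≡n (m≤n⇒m≤1+n r≤E)))

    module AtPivot (P : Pivot) where

      open Pivot P

      q : ℕ → Fin n
      q = path v a

      ℓ-q : ∀ {j} → j ≤ ℓ a → ℓ (q j) ≡ j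
      ℓ-q = d-path v a

      -- J is the last level at which the geodesics to far and to a agree.
      branch : ∃ λ J → J ≤ ℓ a × q J ≡ p J × (∀ {j} → J < j → j ≤ ℓ a → q j ≢ p j)
      branch = lastBelow (λ j → q j Fin.≟ p j) refl (ℓ a)

      J : ℕ
      J = proj₁ branch

      J≤ℓa : J ≤ ℓ a
      J≤ℓa = proj₁ (proj₂ branch)

      J≤E : J ≤ E
      J≤E = ≤-trans J≤ℓa (ℓ≤E a)

      qJ≡pJ : q J ≡ p J
      qJ≡pJ = proj₁ (proj₂ (proj₂ branch))

      d[pJ,a]≤ : d (p J) a ≤ ℓ a ∸ J
      d[pJ,a]≤ = subst (λ z → d z a ≤ ℓ a ∸ J) qJ≡pJ (d-path-end v a J≤ℓa)

      separated : ∀ {i j} → J < j → j ≤ ℓ a → i ≤ E → q j ≢ p i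
      separated {i} {j} J<j j≤ℓa i≤E qj≡pi = proj₂ (proj₂ (proj₂ branch)) J<j j≤ℓa (trans qj≡pi (cong p i≡j))
        where
        i≡j : i ≡ j
        i≡j = trans (sym (ℓ-p i≤E)) (trans (cong ℓ (sym qj≡pi)) (ℓ-q j≤ℓa))

      J<s : J < s
      J<s = ≰⇒> λ s≤J → <-irrefl refl (<-≤-trans not-behind (behind s≤J))
        where
        behind : s ≤ J → s + d (p s) a ≤ ℓ a
        behind s≤J = begin
          s + d (p s) a                     ≤⟨ +-monoʳ-≤ s (d-triangle (p s) (p J) a) ⟩
          s + (d (p s) (p J) + d (p J) a)   ≤⟨ +-monoʳ-≤ s (+-mono-≤ (d-path-path v far s≤J J≤E) d[pJ,a]≤) ⟩
          s + ((J ∸ s) + (ℓ a ∸ J))         ≡⟨ +-assoc s (J ∸ s) (ℓ a ∸ J) ⟨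
          s + (J ∸ s) + (ℓ a ∸ J)           ≡⟨ cong (_+ (ℓ a ∸ J)) (m+[n∸m]≡n s≤J) ⟩
          J + (ℓ a ∸ J)                     ≡⟨ m+[n∸m]≡n J≤ℓa ⟩
          ℓ a                               ∎
          where open ≤-Reasoning

      r+2J≤s+ℓa : r + (J + J) ≤ s + ℓ a
      r+2J≤s+ℓa = begin
        r + (J + J)                                ≤⟨ +-monoˡ-≤ (J + J) (≤-trans r≤d[ps,a] (d-triangle (p s) (p J) a)) ⟩
        (d (p s) (p J) + d (p J) a) + (J + J)      ≤⟨ +-monoˡ-≤ (J + J) (+-mono-≤ d[ps,pJ]≤ d[pJ,a]≤) ⟩
        ((s ∸ J) + (ℓ a ∸ J)) + (J + J)            ≡⟨ interchange (s ∸ J) (ℓ a ∸ J) J J ⟩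
        ((s ∸ J) + J) + ((ℓ a ∸ J) + J)            ≡⟨ cong₂ _+_ (m∸n+n≡m (<⇒≤ J<s)) (m∸n+n≡m J≤ℓa) ⟩
        s + ℓ a                                    ∎
        where
        open ≤-Reasoning
        d[ps,pJ]≤ : d (p s) (p J) ≤ s ∸ J
        d[ps,pJ]≤ = subst (_≤ s ∸ J) (d-sym (p J) (p s)) (d-path-path v far (<⇒≤ J<s) (s≤E r+s≤1+E))

      r≤s+ℓa : r ≤ s + ℓ a
      r≤s+ℓa = ≤-trans (m≤m+n r (J + J)) r+2J≤s+ℓa

      -- p t … p E and, above the branch point, q (t ⊔ (1 + J)) … q (ℓ a) are distinct vertices of level ≥ t.
      high-levels : ∀ t → (suc E ∸ t) + (suc (ℓ a) ∸ (t ⊔ suc J)) ≤ countAtLeast t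
      high-levels t = begin
        (suc E ∸ t) + (suc (ℓ a) ∸ M)      ≡⟨ cong₂ _+_ (length-applyUpTo _ (suc E ∸ t)) (length-applyUpTo _ (suc (ℓ a) ∸ M)) ⟨
        length Ps + length Qs              ≡⟨ length-++ Ps ⟨
        length (Ps ++ Qs)                  ≤⟨ length≤countAtLeast unique high ⟩
        countAtLeast t                     ∎
        where
        open ≤-Reasoning
        M : ℕ
        M = t ⊔ suc J
        Ps Qs : List (Fin n)
        Ps = segment p t (suc E ∸ t)
        Qs = segment q M (suc (ℓ a) ∸ M)
        p-index≤E : ∀ {i} → i < suc E ∸ t → t + i ≤ E
        p-index≤E i<1+E∸t = ≤-pred (i<m∸a⇒a+i<m t (suc E) i<1+E∸t)
        q-index≤ℓa : ∀ {j} → j < suc (ℓ a) ∸ M → M + j ≤ ℓ a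
        q-index≤ℓa j<1+ℓa∸M = ≤-pred (i<m∸a⇒a+i<m M (suc (ℓ a)) j<1+ℓa∸M)
        disjoint : Disjoint Ps Qs
        disjoint (x∈Ps , x∈Qs) with ∈-applyUpTo⁻ _ x∈Ps | ∈-applyUpTo⁻ _ x∈Qs
        ... | i , i< , refl | j , j< , x≡q[M+j] =
          separated (<-≤-trans (m≤n⊔m t (suc J)) (m≤m+n M j)) (q-index≤ℓa j<) (p-index≤E i<) (sym x≡q[M+j])
        unique : Unique (Ps ++ Qs)
        unique = Uniqueₚ.++⁺ (segment-unique p t _ (ℓ-p ∘ p-index≤E)) (segment-unique q M _ (ℓ-q ∘ q-index≤ℓa)) disjoint
        high : All (λ x → t ≤ ℓ x) (Ps ++ Qs)
        high = Allₚ.++⁺ (segment-high p t _ (ℓ-p ∘ p-index≤E) ≤-refl) (segment-high q M _ (ℓ-q ∘ q-index≤ℓa) (m≤m⊔n t (suc J)))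

      thickness-bound : ∀ {t} → 1 ≤ t → t ≤ r → suc (2 * (r ∸ t)) + (t + (t ⊔ suc J)) ≤ suc E + suc (ℓ a)
      thickness-bound {t} 1≤t t≤r with ≤-total (suc J) t
      ... | inj₁ J<t   = subst (λ M → suc (2 * (r ∸ t)) + (t + M) ≤ suc E + suc (ℓ a)) (sym (m≥n⇒m⊔n≡m J<t))
                               (branch-below-bound r+s≤1+E r≤s+ℓa t≤r)
      ... | inj₂ t≤1+J = subst (λ M → suc (2 * (r ∸ t)) + (t + M) ≤ suc E + suc (ℓ a)) (sym (m≤n⇒m⊔n≡n t≤1+J))
                               (branch-above-bound r+s≤1+E r+2J≤s+ℓa 1≤t t≤r)

      thick : ∀ {t} → 1 ≤ t → t ≤ r → suc (2 * (r ∸ t)) ≤ countAtLeast t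
      thick {t} 1≤t t≤r = ≤-trans (≤-∸+∸ {a = t} {t ⊔ suc J} {suc E} {suc (ℓ a)} (thickness-bound 1≤t t≤r)) (high-levels t)

  levels-thick : ∀ {t} → 1 ≤ t → t ≤ r → suc (2 * (r ∸ t)) ≤ countAtLeast t
  levels-thick 1≤t t≤r = AtPivot.thick 1≤r (pivot 1≤r) 1≤t t≤r
    where
    1≤r : 1 ≤ r
    1≤r = ≤-trans 1≤t t≤r

-- The equality case

-- The path w k … w 0 u 0 … u k of the statement; w i and u i are the paper's w_{i+1} and u_{i+1}.
ExtremalPath : ∀ {n} → SimpleGraph n → Fin n → (Fin n → Fin n → ℕ) → ℕ → ℕ → Set
ExtremalPath {n} G v d r k =
  Σ (Fin (suc k) → Fin n) λ w →
  Σ (Fin (suc k) → Fin n) λ u →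
    (w fzero ≡ v)
    × (∀ i j → w i ≡ w j → i ≡ j)
    × (∀ i j → u i ≡ u j → i ≡ j)
    × (∀ i j → w i ≢ u j)
    × (∀ (i : Fin k) → Adj G (w (fsuc i)) (w (inject₁ i)))
    × Adj G (w fzero) (u fzero)
    × (∀ (i : Fin k) → Adj G (u (inject₁ i)) (u (fsuc i)))
    × (d (w (fromℕ k)) (u fzero) ≡ r)
    × (d (w fzero) (u (fromℕ k)) ≡ r)
    × (∀ x → (∀ i → x ≢ w i) → (∀ i → x ≢ u i) → d v x ≡ 1)

module _ {n} {G : SimpleGraph n} {d : Fin n → Fin n → ℕ} (isDist : IsDistanceFn G d) where

  open Distance isDist

  surplus≤square : ∀ {v r k} → ExtremalPath G v d r k → surplus d v ≤ k * k
  surplus≤square {v} {k = k} (w , u , w₀≡v , _ , _ , _ , w-adj , w₀–u₀ , u-adj , _ , _ , outside≡1) = begin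
    ∑[ x < n ] h x                                                      ≤⟨ ∑≤sum-map h (tabulate w ++ tabulate u) outside≡0 ⟩
    sum (map h (tabulate w ++ tabulate u))
      ≡⟨ trans (cong sum (map-++ h (tabulate w) (tabulate u))) (sum-++ (map h (tabulate w)) _) ⟩
    sum (map h (tabulate w)) + sum (map h (tabulate u))
      ≡⟨ cong₂ _+_ (sum-map-tabulate h w) (sum-map-tabulate h u) ⟩
    ∑[ i < suc k ] h (w i) + ∑[ i < suc k ] h (u i)
      ≤⟨ +-mono-≤ (∑-mono-≤ (∸-monoˡ-≤ 1 ∘ w-level)) (∑-mono-≤ (∸-monoˡ-≤ 1 ∘ u-level)) ⟩
    ∑[ i < suc k ] (toℕ i ∸ 1) + ∑[ i < suc k ] toℕ i                   ≡⟨ ∑-distrib-+ {suc k} (λ i → toℕ i ∸ 1) toℕ ⟨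
    ∑[ i < k ] (toℕ i + suc (toℕ i))                                    ≡⟨ sum-cong-≗ {k} (n+[1+n]≡1+2*n ∘ toℕ) ⟩
    ∑[ i < k ] suc (2 * toℕ i)                                          ≡⟨ ∑-odd k ⟩
    k * k                                                               ∎
    where
    open ≤-Reasoning
    h : Fin n → ℕ
    h x = d v x ∸ 1
    w-level : ∀ i → d v (w i) ≤ toℕ i
    w-level = subst (λ z → ∀ i → d z (w i) ≤ toℕ i) w₀≡v (d-chain w (λ i → SimpleGraph.sym G (w-adj i)))
    u-level : ∀ i → d v (u i) ≤ suc (toℕ i)
    u-level i = begin
      d v (u i)                      ≤⟨ d-triangle v (u fzero) (u i) ⟩
      d v (u fzero) + d (u fzero) (u i) ≤⟨ +-mono-≤ (subst (λ z → d z (u fzero) ≤ 1) w₀≡v (d-adj w₀–u₀)) (d-chain u u-adj i) ⟩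
      suc (toℕ i)                    ∎
    outside≡0 : ∀ x → x ∉ tabulate w ++ tabulate u → h x ≡ 0
    outside≡0 x x∉ = cong (_∸ 1) (outside≡1 x
      (λ i x≡wi → x∉ (∈-++⁺ˡ (subst (_∈ tabulate w) (sym x≡wi) (∈-tabulate⁺ {f = w} i))))
      (λ i x≡ui → x∉ (∈-++⁺ʳ (tabulate w) (subst (_∈ tabulate u) (sym x≡ui) (∈-tabulate⁺ {f = u} i)))))

module EqualityCase {m} {G : SimpleGraph (suc m)} {d : Fin (suc m) → Fin (suc m) → ℕ} (isDist : IsDistanceFn G d)
             (v : Fin (suc m)) (k : ℕ) (r≤ecc : ∀ y → suc k ≤ ecc d y)
             {d′ : Fin m → Fin m → ℕ} (r≤ecc′ : ∀ y → suc k ≤ ecc d′ y)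
             (restrict : ∀ x y → d′ x y ≡ d (punchIn v x) (punchIn v y))
             (tight : surplus d v ≤ k * k) where

  open Distance isDist
  open LevelStructure isDist v (suc k) r≤ecc
  open Thick k (λ 2≤t → levels-thick (≤-trans (s≤s z≤n) 2≤t))
  open Tight tight

  E≡1+k : E ≡ suc k
  E≡1+k = ≤-antisym (ℓ≤1+k far) r≤E

  ℓ-p′ : ∀ {i} → i ≤ suc k → ℓ (p i) ≡ i
  ℓ-p′ i≤1+k = ℓ-p (subst (_ ≤_) (sym E≡1+k) i≤1+k)

  d[p1,v]≡1 : d (p 1) v ≡ 1
  d[p1,v]≡1 = trans (d-sym (p 1) v) (ℓ-p′ (s≤s z≤n))

  v≢p1 : v ≢ p 1
  v≢p1 v≡p1 = 0≢1+n (trans (sym (d-refl (p 1))) (trans (cong (d (p 1)) (sym v≡p1)) d[p1,v]≡1))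

  d[p1,x]≤1+ℓx : ∀ x → d (p 1) x ≤ suc (ℓ x)
  d[p1,x]≤1+ℓx x = subst (λ z → d (p 1) x ≤ z + ℓ x) d[p1,v]≡1 (d-triangle (p 1) v x)

  -- For k = 0 take a = v; otherwise a is a vertex of G − v far from p 1.
  partner : ∃ λ a → ℓ a ≡ k × suc k ≤ d (p 1) a
  partner = choose k refl
    where
    choose : ∀ j → k ≡ j → ∃ λ a → ℓ a ≡ k × suc k ≤ d (p 1) a
    choose zero    k≡0   = v , trans (d-refl v) (sym k≡0) , subst (λ j → suc j ≤ d (p 1) v) (sym k≡0) (≤-reflexive (sym d[p1,v]≡1))
    choose (suc j) k≡1+j = a , ℓa≡k , 1+k≤d[p1,a]
      where
      witness : ∃ λ a′ → suc k ≤ d′ (punchOut v≢p1) a′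
      witness = ecc-witness d′ (punchOut v≢p1) (r≤ecc′ (punchOut v≢p1))
      a : Fin (suc m)
      a = punchIn v (proj₁ witness)
      1+k≤d[p1,a] : suc k ≤ d (p 1) a
      1+k≤d[p1,a] = subst (λ z → suc k ≤ d z a) (Finₚ.punchIn-punchOut v≢p1)
                          (subst (suc k ≤_) (restrict _ (proj₁ witness)) (proj₂ witness))
      a≢p[1+k] : a ≢ p (suc k)
      a≢p[1+k] a≡p[1+k] = <-irrefl refl (<-≤-trans (s≤s (d-path-path v far (s≤s z≤n) (≤-reflexive (sym E≡1+k))))
                                                     (subst (λ z → suc k ≤ d (p 1) z) a≡p[1+k] 1+k≤d[p1,a]))
      ℓa≢1+k : ℓ a ≢ suc k
      ℓa≢1+k ℓa≡1+k = <-irrefl refl (<-≤-trans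
        (length≤countAtLeast ((a≢p[1+k] ∷ []) ∷ [] ∷ []) (≤-reflexive (sym ℓa≡1+k) ∷ ≤-reflexive (sym (ℓ-p′ ≤-refl)) ∷ []))
        (≤-trans (countAtLeast≤ (subst (2 ≤_) (cong suc (sym k≡1+j)) (s≤s (s≤s z≤n))) ≤-refl)
                 (≤-reflexive (cong (λ z → suc (2 * z)) (n∸n≡0 k)))))
      ℓa≡k : ℓ a ≡ k
      ℓa≡k = ≤-antisym (≤-pred (≤∧≢⇒< (ℓ≤1+k a) ℓa≢1+k)) (≤-pred (≤-trans 1+k≤d[p1,a] (d[p1,x]≤1+ℓx a)))

  a : Fin (suc m)
  a = proj₁ partner

  ℓa≡k : ℓ a ≡ k
  ℓa≡k = proj₁ (proj₂ partner)

  q : ℕ → Fin (suc m)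
  q = path v a

  ℓ-q : ∀ {j} → j ≤ k → ℓ (q j) ≡ j
  ℓ-q j≤k = d-path v a (subst (_ ≤_) (sym ℓa≡k) j≤k)

  d[p1,a]≡1+k : d (p 1) a ≡ suc k
  d[p1,a]≡1+k = ≤-antisym (subst (λ j → d (p 1) a ≤ suc j) ℓa≡k (d[p1,x]≤1+ℓx a)) (proj₂ (proj₂ partner))

  q≢p : ∀ {i j} → 1 ≤ j → j ≤ k → i ≤ suc k → q j ≢ p i
  q≢p {i} {j} 1≤j j≤k i≤1+k qj≡pi = <-irrefl refl (<-≤-trans (s≤s short) (≤-reflexive (sym d[p1,a]≡1+k)))
    where
    j≤ℓa : j ≤ ℓ a
    j≤ℓa = subst (j ≤_) (sym ℓa≡k) j≤k
    qj≡pj : q j ≡ p j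
    qj≡pj = trans qj≡pi (cong p (trans (sym (ℓ-p′ i≤1+k)) (trans (cong ℓ (sym qj≡pi)) (ℓ-q j≤k))))
    open ≤-Reasoning
    short : d (p 1) a ≤ k
    short = begin
      d (p 1) a                      ≤⟨ d-triangle (p 1) (p j) a ⟩
      d (p 1) (p j) + d (p j) a      ≤⟨ +-mono-≤ (d-path-path v far 1≤j (subst (j ≤_) (sym E≡1+k) (m≤n⇒m≤1+n j≤k)))
                                                 (subst (λ z → d z a ≤ ℓ a ∸ j) qj≡pj (d-path-end v a j≤ℓa)) ⟩
      (j ∸ 1) + (ℓ a ∸ j)            ≤⟨ +-monoˡ-≤ (ℓ a ∸ j) (m∸n≤m j 1) ⟩
      j + (ℓ a ∸ j)                  ≡⟨ m+[n∸m]≡n j≤ℓa ⟩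
      ℓ a                            ≡⟨ ℓa≡k ⟩
      k                              ∎

  w u : Fin (suc k) → Fin (suc m)
  w i = q (toℕ i)
  u i = p (suc (toℕ i))

  toℕ≤k : ∀ (i : Fin (suc k)) → toℕ i ≤ k
  toℕ≤k i = ≤-pred (Finₚ.toℕ<n i)

  ℓ-w : ∀ i → ℓ (w i) ≡ toℕ i
  ℓ-w i = ℓ-q (toℕ≤k i)

  ℓ-u : ∀ i → ℓ (u i) ≡ suc (toℕ i)
  ℓ-u i = ℓ-p′ (s≤s (toℕ≤k i))

  w-injective : ∀ i j → w i ≡ w j → i ≡ j
  w-injective i j wi≡wj = Finₚ.toℕ-injective (trans (sym (ℓ-w i)) (trans (cong ℓ wi≡wj) (ℓ-w j)))

  u-injective : ∀ i j → u i ≡ u j → i ≡ j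
  u-injective i j ui≡uj = Finₚ.toℕ-injective (suc-injective (trans (sym (ℓ-u i)) (trans (cong ℓ ui≡uj) (ℓ-u j))))

  w≢u : ∀ i j → w i ≢ u j
  w≢u i j wi≡uj = q≢p (subst (1 ≤_) (sym levels) (s≤s z≤n)) (toℕ≤k i) (s≤s (toℕ≤k j)) wi≡uj
    where
    levels : toℕ i ≡ suc (toℕ j)
    levels = trans (sym (ℓ-w i)) (trans (cong ℓ wi≡uj) (ℓ-u j))

  w-adj : ∀ (i : Fin k) → Adj G (w (fsuc i)) (w (inject₁ i))
  w-adj i = subst (λ j → Adj G (w (fsuc i)) (q j)) (sym (Finₚ.toℕ-inject₁ i))
                  (SimpleGraph.sym G (path-adj v a (subst (suc (toℕ i) ≤_) (sym ℓa≡k) (Finₚ.toℕ<n i))))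

  u-adj : ∀ (i : Fin k) → Adj G (u (inject₁ i)) (u (fsuc i))
  u-adj i = subst (λ j → Adj G (p (suc j)) (u (fsuc i))) (sym (Finₚ.toℕ-inject₁ i))
                  (path-adj v far (subst (suc (suc (toℕ i)) ≤_) (sym E≡1+k) (s≤s (Finₚ.toℕ<n i))))

  w₀–u₀ : Adj G (w fzero) (u fzero)
  w₀–u₀ = path-adj v far (subst (1 ≤_) (sym E≡1+k) (s≤s z≤n))

  d[w-end,u₀]≡1+k : d (w (fromℕ k)) (u fzero) ≡ suc k
  d[w-end,u₀]≡1+k = begin
    d (q (toℕ (fromℕ k))) (p 1)  ≡⟨ cong (λ j → d (q j) (p 1)) (Finₚ.toℕ-fromℕ k) ⟩
    d (q k) (p 1)                ≡⟨ cong (λ z → d z (p 1)) (subst (λ j → q j ≡ a) ℓa≡k (path-end v a)) ⟩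
    d a (p 1)                    ≡⟨ d-sym a (p 1) ⟩
    d (p 1) a                    ≡⟨ d[p1,a]≡1+k ⟩
    suc k                        ∎
    where open ≡-Reasoning

  d[w₀,u-end]≡1+k : d (w fzero) (u (fromℕ k)) ≡ suc k
  d[w₀,u-end]≡1+k = trans (cong (λ j → ℓ (p (suc j))) (Finₚ.toℕ-fromℕ k)) (ℓ-p′ ≤-refl)

  outside≡1 : ∀ x → (∀ i → x ≢ w i) → (∀ i → x ≢ u i) → ℓ x ≡ 1
  outside≡1 x x∉w x∉u = ≤-antisym (≮⇒≥ (crowded k refl)) (n≢0⇒n>0 λ ℓx≡0 → x∉w fzero (sym (d≡0⇒≡ ℓx≡0)))
    where
    -- Otherwise x, q 2 … q k and p 2 … p (k + 1) are 2k vertices of level ≥ 2, one more than tightness allows.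
    crowded : ∀ j → k ≡ j → ¬ 1 < ℓ x
    crowded zero    k≡0   1<ℓx = <-irrefl refl (<-≤-trans 1<ℓx (subst (λ j → ℓ x ≤ suc j) k≡0 (ℓ≤1+k x)))
    crowded (suc j) k≡1+j 1<ℓx = too-many (subst (λ k → suc (j + k) ≤ suc (2 * (k ∸ 1))) k≡1+j (begin
      suc (j + k)                        ≡⟨ cong suc (cong₂ _+_ (length-applyUpTo _ j) (length-applyUpTo _ k)) ⟨
      suc (length Qs + length Ps)        ≡⟨ cong suc (length-++ Qs) ⟨
      length (x ∷ Qs ++ Ps)              ≤⟨ length≤countAtLeast unique high ⟩
      countAtLeast 2                     ≤⟨ countAtLeast≤ ≤-refl (subst (λ k → 2 ≤ suc k) (sym k≡1+j) (s≤s (s≤s z≤n))) ⟩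
      suc (2 * (k ∸ 1))                  ∎))
      where
      open ≤-Reasoning
      Qs Ps : List (Fin (suc m))
      Qs = segment q 2 j
      Ps = segment p 2 k
      2+i≤k : ∀ {i} → i < j → 2 + i ≤ k
      2+i≤k i<j = subst (_ ≤_) (sym k≡1+j) (s≤s i<j)
      graded-q : ∀ {i} → i < j → ℓ (q (2 + i)) ≡ 2 + i
      graded-q i<j = ℓ-q (2+i≤k i<j)
      graded-p : ∀ {i} → i < k → ℓ (p (2 + i)) ≡ 2 + i
      graded-p i<k = ℓ-p′ (s≤s i<k)
      x∉Qs : All (x ≢_) Qs
      x∉Qs = Allₚ.applyUpTo⁺₁ _ j λ {i} i<j →
        subst (λ z → x ≢ q z) (Finₚ.toℕ-fromℕ< (s≤s (2+i≤k i<j))) (x∉w (fromℕ< (s≤s (2+i≤k i<j))))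
      x∉Ps : All (x ≢_) Ps
      x∉Ps = Allₚ.applyUpTo⁺₁ _ k λ {i} i<k →
        subst (λ z → x ≢ p (suc z)) (Finₚ.toℕ-fromℕ< (s≤s i<k)) (x∉u (fromℕ< (s≤s i<k)))
      disjoint : Disjoint Qs Ps
      disjoint (y∈Qs , y∈Ps) with ∈-applyUpTo⁻ _ y∈Qs | ∈-applyUpTo⁻ _ y∈Ps
      ... | i , i<j , refl | i′ , i′<k , eq = q≢p (s≤s z≤n) (2+i≤k i<j) (s≤s i′<k) eq
      unique : Unique (x ∷ Qs ++ Ps)
      unique = Allₚ.++⁺ x∉Qs x∉Ps ∷ Uniqueₚ.++⁺ (segment-unique q 2 j graded-q) (segment-unique p 2 k graded-p) disjoint
      high : All (λ y → 2 ≤ ℓ y) (x ∷ Qs ++ Ps)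
      high = 1<ℓx ∷ Allₚ.++⁺ (segment-high q 2 j graded-q ≤-refl) (segment-high p 2 k graded-p ≤-refl)
      too-many : ¬ suc (j + suc j) ≤ suc (2 * j)
      too-many = <⇒≱ (≤-reflexive (cong suc (sym (n+[1+n]≡1+2*n j))))

  extremal-path : ExtremalPath G v d (suc k) k
  extremal-path = w , u , refl , w-injective , u-injective , w≢u , w-adj , w₀–u₀ , u-adj , d[w-end,u₀]≡1+k , d[w₀,u-end]≡1+k , outside≡1

square≤surplus : ∀ {n} {G : SimpleGraph n} {d : Fin n → Fin n → ℕ} → IsDistanceFn G d →
                 ∀ v {k} → (∀ y → suc k ≤ ecc d y) → k * k ≤ surplus d v
square≤surplus isDist v {k} r≤ecc = Thick.square≤∑ k (λ 2≤t → levels-thick (≤-trans (s≤s z≤n) 2≤t))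
  where open LevelStructure isDist v (suc k) r≤ecc

x^2≡x*x : ∀ x → x ^ 2 ≡ x * x
x^2≡x*x x = cong (x *_) (*-identityʳ x)

lemma4 : ∀ (m : ℕ) (G : SimpleGraph (suc m)) (v : Fin (suc m))
             (d : Fin (suc m) → Fin (suc m) → ℕ) (d' : Fin m → Fin m → ℕ) (r : ℕ) →
             IsDistanceFn G d →
             IsDistanceFn (deleteVertex G v) d' →
             IsRadius d r →
             IsRadius d' r →
             (∀ x y → d' x y ≡ d (punchIn v x) (punchIn v y)) →
             (wiener d' + (suc m ∸ 1) + (r ∸ 1) ^ 2 ≤ wiener d)
             × ((wiener d ≡ wiener d' + (suc m ∸ 1) + (r ∸ 1) ^ 2)
                ⇔ (∃ λ k → r ≡ suc k ×
                     Σ (Fin (suc k) → Fin (suc m)) λ w →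
                     Σ (Fin (suc k) → Fin (suc m)) λ u →
                       (w fzero ≡ v)
                       × (∀ i j → w i ≡ w j → i ≡ j)
                       × (∀ i j → u i ≡ u j → i ≡ j)
                       × (∀ i j → w i ≢ u j)
                       × (∀ (i : Fin k) → Adj G (w (fsuc i)) (w (inject₁ i)))
                       × Adj G (w fzero) (u fzero)
                       × (∀ (i : Fin k) → Adj G (u (inject₁ i)) (u (fsuc i)))
                       × (d (w (fromℕ k)) (u fzero) ≡ r)
                       × (d (w fzero) (u (fromℕ k)) ≡ r)
                       × (∀ x → (∀ i → x ≢ w i) → (∀ i → x ≢ u i) → d v x ≡ 1)))
lemma4 m G v d d′ zero isDist _ ((center , ecc≡0) , _) ((x₀ , _) , _) _ =
  contradiction (subst (1 ≤_) ecc≡0 (Distance.ecc-positive isDist (Finₚ.punchInᵢ≢i v x₀) center)) λ ()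
lemma4 m G v d d′ (suc k) isDist _ (_ , r≤ecc) (_ , r≤ecc′) restrict = lower-bound , mk⇔ extremal-if-equal equal-if-extremal
  where
  decomposition : wiener d ≡ wiener d′ + m + surplus d v
  decomposition = wiener-deleteVertex isDist v restrict

  lower-bound : wiener d′ + m + k ^ 2 ≤ wiener d
  lower-bound = subst₂ _≤_ (cong (wiener d′ + m +_) (sym (x^2≡x*x k))) (sym decomposition)
                           (+-monoʳ-≤ (wiener d′ + m) (square≤surplus isDist v r≤ecc))

  extremal-if-equal : wiener d ≡ wiener d′ + m + k ^ 2 → ∃ λ j → suc k ≡ suc j × ExtremalPath G v d (suc k) j
  extremal-if-equal wiener≡ = k , refl , EqualityCase.extremal-path isDist v k r≤ecc r≤ecc′ restrict (≤-reflexive surplus≡k²)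
    where
    surplus≡k² : surplus d v ≡ k * k
    surplus≡k² = trans (+-cancelˡ-≡ (wiener d′ + m) _ _ (trans (sym decomposition) wiener≡)) (x^2≡x*x k)

  equal-if-extremal : (∃ λ j → suc k ≡ suc j × ExtremalPath G v d (suc k) j) → wiener d ≡ wiener d′ + m + k ^ 2
  equal-if-extremal (_ , refl , path) = trans decomposition (cong (wiener d′ + m +_)
    (trans (≤-antisym (surplus≤square isDist path) (square≤surplus isDist v r≤ecc)) (sym (x^2≡x*x k))))
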